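{- Let $\omega=-\frac12+\mathbf{i}\frac{\sqrt3}{2}$. Let $M_G$ be a mixed graph and $V(M_G)=V_1\cup V_2\cup V_3$ any partition into three (possibly empty) sets. If $M_G'$ is obtained from $M_G$ by the three-way switching with respect to this partition, then $M_G'$ is cospectral with $M_G$.
   Context: A mixed graph $M_G$ is obtained from a simple graph $G$ by leaving some edges undirected and replacing each other edge by an arc. Its Hermitian adjacency matrix $H(M_G)=(h_{uv})$ has $h_{uv}=\omega$ if there is an arc from $u$ to $v$, $h_{uv}=\overline{\omega}$ if there is an arc from $v$ to $u$, $h_{uv}=1$ if $uv$ is an undirected edge, and $0$ otherwise. Cospectral means the Hermitian adjacency matrices have the same eigenvalues with multiplicities. An arc from $x$ to $y$, or an undirected edge $\{x,y\}$, is of type $(\omega^i,\omega^j)$ if $x\in V_i$, $y\in V_j$. The three-way switching: (i) replaces each undirected edge $\{x,y\}$ of type $(\omega^i,\omega^j)$ with $j-i\equiv1\pmod 3$ by the arc from $x$ to $y$; (ii) replaces each arc of type $(\omega^i,\omega^j)$ with $i-j\equiv1\pmod 3$ by an undirected edge; (iii) reverses the direction of each arc of type $(\omega^i,\omega^j)$ with $i-j\equiv 2\pmod 3$; everything else is unchanged. -}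

module Defs where

open import Data.Nat as ℕ using (ℕ; zero; suc; _∸_)
open import Data.Integer as ℤ using (ℤ; +_; -[1+_])
open import Data.Fin using (Fin; zero; suc; punchIn)
open import Relation.Binary.PropositionalEquality using (_≡_; refl)

-- Eisenstein integers ℤ[ω], ω = -1/2 + i √3/2, so ω² = -1 - ω.
-- The element  a + b ω  is represented as  a ⊕ω b.
-- All entries of the Hermitian adjacency matrix (0, 1, ω, ω̄) lie here.

infix 4 _⊕ω_
record 𝔼 : Set where
  constructor _⊕ω_
  field
    re : ℤ
    im : ℤ
open 𝔼 public

0𝔼 1𝔼 ω ω̄ : 𝔼
0𝔼 = + 0 ⊕ω + 0
1𝔼 = + 1 ⊕ω + 0
ω  = + 0 ⊕ω + 1
ω̄  = -[1+ 0 ] ⊕ω -[1+ 0 ]      -- conj ω = ω² = -1 - ω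

infixl 6 _+𝔼_
infixl 7 _*𝔼_

_+𝔼_ : 𝔼 → 𝔼 → 𝔼
(a ⊕ω b) +𝔼 (c ⊕ω d) = (a ℤ.+ c) ⊕ω (b ℤ.+ d)

-𝔼_ : 𝔼 → 𝔼
-𝔼 (a ⊕ω b) = (ℤ.- a) ⊕ω (ℤ.- b)

-- (a + bω)(c + dω) = (ac - bd) + (ad + bc - bd) ω
_*𝔼_ : 𝔼 → 𝔼 → 𝔼
(a ⊕ω b) *𝔼 (c ⊕ω d) =
  (a ℤ.* c ℤ.- b ℤ.* d) ⊕ω (a ℤ.* d ℤ.+ b ℤ.* c ℤ.- b ℤ.* d)

-- Polynomials over ℤ[ω] in one indeterminate x, as coefficient
-- sequences (coefficient of x^k at k; finitely supported in practice).

Poly : Set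
Poly = ℕ → 𝔼

constP : 𝔼 → Poly
constP c zero    = c
constP c (suc k) = 0𝔼

X : Poly
X 1 = 1𝔼
X _ = 0𝔼

_+P_ : Poly → Poly → Poly
(p +P q) k = p k +𝔼 q k

-P_ : Poly → Poly
(-P p) k = -𝔼 p k

sumTo : (ℕ → 𝔼) → ℕ → 𝔼
sumTo f zero    = f zero
sumTo f (suc k) = sumTo f k +𝔼 f (suc k)

_*P_ : Poly → Poly → Poly
(p *P q) k = sumTo (λ i → p i *𝔼 q (k ∸ i)) k

Matrix : Set → ℕ → Set
Matrix A n = Fin n → Fin n → A

altSum : ∀ {n} → (Fin n → Poly) → Poly
altSum {zero}  f = constP 0𝔼
altSum {suc n} f = f zero +P (-P altSum (λ j → f (suc j)))

det : ∀ {n} → Matrix Poly n → Poly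
det {zero}  M = constP 1𝔼
det {suc n} M =
  altSum (λ j → M zero j *P det (λ r c → M (suc r) (punchIn j c)))

δ : ∀ {n} → Fin n → Fin n → 𝔼
δ zero    zero    = 1𝔼
δ zero    (suc j) = 0𝔼
δ (suc i) zero    = 0𝔼
δ (suc i) (suc j) = δ i j

charPoly : ∀ {n} → Matrix 𝔼 n → Poly
charPoly H = det (λ i j → (X *P constP (δ i j)) +P (-P constP (H i j)))

-- Cospectral: same eigenvalues with multiplicities, i.e. the same
-- characteristic polynomial.
Cospectral : ∀ {n} → Matrix 𝔼 n → Matrix 𝔼 n → Set
Cospectral H H' = ∀ k → charPoly H k ≡ charPoly H' k

-- Mixed graphs on vertex set Fin n.
-- rel u v = none : u,v non-adjacent
--           und  : undirected edge {u,v}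
--           out  : arc from u to v
--           inn  : arc from v to u

data Adj : Set where
  none und out inn : Adj

flipAdj : Adj → Adj
flipAdj none = none
flipAdj und  = und
flipAdj out  = inn
flipAdj inn  = out

record MixedGraph (n : ℕ) : Set where
  field
    rel    : Fin n → Fin n → Adj
    rel-sym   : ∀ u v → rel v u ≡ flipAdj (rel u v)
    rel-irrefl : ∀ u → rel u u ≡ none
open MixedGraph public

hEntry : Adj → 𝔼
hEntry none = 0𝔼
hEntry und  = 1𝔼
hEntry out  = ω
hEntry inn  = ω̄

herm : ∀ {n} → MixedGraph n → Matrix 𝔼 n
herm M u v = hEntry (rel M u v)

-- Three-way switching.  A partition V = V₀ ∪ V₁ ∪ V₂ (parts possibly
-- empty) is a map  part : Fin n → Fin 3  (u ∈ V_i iff part u = i;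
-- the paper's V₁,V₂,V₃ with exponents taken mod 3).

-- diff i j = (j - i) mod 3
diff : Fin 3 → Fin 3 → Fin 3
diff zero          zero          = zero
diff zero          (suc zero)    = suc zero
diff zero          (suc (suc zero)) = suc (suc zero)
diff (suc zero)    zero          = suc (suc zero)
diff (suc zero)    (suc zero)    = zero
diff (suc zero)    (suc (suc zero)) = suc zero
diff (suc (suc zero)) zero       = suc zero
diff (suc (suc zero)) (suc zero) = suc (suc zero)
diff (suc (suc zero)) (suc (suc zero)) = zero

-- new relation of the ordered pair (u,v), u ∈ V_i, v ∈ V_j, d = j - i mod 3
--  (i)   undirected {u,v}, j-i≡1 : arc u→v ; j-i≡2 (i.e. i-j≡1 for (v,u)) : arc v→u
--  (ii)  arc u→v with i-j≡1 (d=2) : undirected ; arc v→u with j-i≡1 (d=1) : undirected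
--  (iii) arc u→v with i-j≡2 (d=1) : reversed ; arc v→u with j-i≡2 (d=2) : reversed
switchAdj : Fin 3 → Adj → Adj
switchAdj d                none = none
switchAdj zero             a    = a
switchAdj (suc zero)       und  = out
switchAdj (suc (suc zero)) und  = inn
switchAdj (suc zero)       out  = inn
switchAdj (suc (suc zero)) out  = und
switchAdj (suc zero)       inn  = und
switchAdj (suc (suc zero)) inn  = out

private
  diff-sym : ∀ i j a → switchAdj (diff j i) (flipAdj a) ≡ flipAdj (switchAdj (diff i j) a)
  diff-sym zero zero none = refl
  diff-sym zero zero und = refl
  diff-sym zero zero out = refl
  diff-sym zero zero inn = refl
  diff-sym zero (suc zero) none = refl
  diff-sym zero (suc zero) und = refl
  diff-sym zero (suc zero) out = refl
  diff-sym zero (suc zero) inn = refl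
  diff-sym zero (suc (suc zero)) none = refl
  diff-sym zero (suc (suc zero)) und = refl
  diff-sym zero (suc (suc zero)) out = refl
  diff-sym zero (suc (suc zero)) inn = refl
  diff-sym (suc zero) zero none = refl
  diff-sym (suc zero) zero und = refl
  diff-sym (suc zero) zero out = refl
  diff-sym (suc zero) zero inn = refl
  diff-sym (suc zero) (suc zero) none = refl
  diff-sym (suc zero) (suc zero) und = refl
  diff-sym (suc zero) (suc zero) out = refl
  diff-sym (suc zero) (suc zero) inn = refl
  diff-sym (suc zero) (suc (suc zero)) none = refl
  diff-sym (suc zero) (suc (suc zero)) und = refl
  diff-sym (suc zero) (suc (suc zero)) out = refl
  diff-sym (suc zero) (suc (suc zero)) inn = refl
  diff-sym (suc (suc zero)) zero none = refl
  diff-sym (suc (suc zero)) zero und = refl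
  diff-sym (suc (suc zero)) zero out = refl
  diff-sym (suc (suc zero)) zero inn = refl
  diff-sym (suc (suc zero)) (suc zero) none = refl
  diff-sym (suc (suc zero)) (suc zero) und = refl
  diff-sym (suc (suc zero)) (suc zero) out = refl
  diff-sym (suc (suc zero)) (suc zero) inn = refl
  diff-sym (suc (suc zero)) (suc (suc zero)) none = refl
  diff-sym (suc (suc zero)) (suc (suc zero)) und = refl
  diff-sym (suc (suc zero)) (suc (suc zero)) out = refl
  diff-sym (suc (suc zero)) (suc (suc zero)) inn = refl

  sw-none : ∀ d → switchAdj d none ≡ none
  sw-none d = refl

  cong' : ∀ {A B : Set} (f : A → B) {x y} → x ≡ y → f x ≡ f y
  cong' f refl = refl

  trans' : ∀ {A : Set} {x y z : A} → x ≡ y → y ≡ z → x ≡ z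
  trans' refl q = q

threeWaySwitch : ∀ {n} → (Fin n → Fin 3) → MixedGraph n → MixedGraph n
threeWaySwitch part M = record
  { rel = λ u v → switchAdj (diff (part u) (part v)) (rel M u v)
  ; rel-sym = λ u v → trans' (cong' (switchAdj (diff (part v) (part u))) (rel-sym M u v))
                              (diff-sym (part u) (part v) (rel M u v))
  ; rel-irrefl = λ u → cong' (switchAdj (diff (part u) (part u))) (rel-irrefl M u)
  }

-- Put D = diag(ω^{i(u)}) for u ∈ V_i.  Rules (i)–(iii) say precisely that the
-- (u,v) entry of the switched matrix is ω^{j−i} h_uv, so H(M_G') = D⁻¹ H(M_G) D
-- with D⁻¹ = D̄.  Scaling row r by a_r and column c by b_c multiplies a
-- determinant by ∏ a · ∏ b; for xI − H with a_r b_r = 1 this factor is 1 and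
-- xI is left unchanged, so the characteristic polynomials agree.

{-# OPTIONS --safe #-}
module Submission where

open import Algebra.Bundles using (CommutativeMonoid)
open import Algebra.Structures using (IsCommutativeMonoid)
import Algebra.Properties.CommutativeMonoid.Sum as MonoidSum
import Algebra.Properties.CommutativeSemigroup as CommutativeSemigroupProperties
open import Data.Fin using (Fin; zero; suc; punchIn)
open import Data.Integer using (_+_; _*_; _-_; -_)
open import Data.Integer.Tactic.RingSolver using (solve)
open import Data.List using (_∷_; [])
open import Data.Nat using (ℕ; zero; suc; _∸_)
open import Data.Vec.Functional using (replicate)
open import Function using (_∘_)
open import Level using (0ℓ)
open import Relation.Binary.PropositionalEquality
open import Relation.Binary.PropositionalEquality.Algebra using (isMagma)
open ≡-Reasoning

open import Defs
open import Algebra.Structures.Biased (_≡_ {A = 𝔼}) using (isCommutativeMonoidˡ)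

-- The solver reduces its goal only to weak head normal form and would treat
-- (x *𝔼 y) .re as an atom, so nested products are written out componentwise.
*𝔼-assoc : ∀ x y z → (x *𝔼 y) *𝔼 z ≡ x *𝔼 (y *𝔼 z)
*𝔼-assoc (a ⊕ω b) (c ⊕ω d) (e ⊕ω f) = cong₂ _⊕ω_ re-assoc im-assoc
  where
  re-assoc : (a * c - b * d) * e - (a * d + b * c - b * d) * f
           ≡ a * (c * e - d * f) - b * (c * f + d * e - d * f)
  re-assoc = solve (a ∷ b ∷ c ∷ d ∷ e ∷ f ∷ [])

  im-assoc : (a * c - b * d) * f + (a * d + b * c - b * d) * e - (a * d + b * c - b * d) * f
           ≡ a * (c * f + d * e - d * f) + b * (c * e - d * f) - b * (c * f + d * e - d * f)
  im-assoc = solve (a ∷ b ∷ c ∷ d ∷ e ∷ f ∷ [])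

*𝔼-comm : ∀ x y → x *𝔼 y ≡ y *𝔼 x
*𝔼-comm (a ⊕ω b) (c ⊕ω d) =
  cong₂ _⊕ω_ (solve (a ∷ b ∷ c ∷ d ∷ [])) (solve (a ∷ b ∷ c ∷ d ∷ []))

*𝔼-identityˡ : ∀ x → 1𝔼 *𝔼 x ≡ x
*𝔼-identityˡ (a ⊕ω b) = cong₂ _⊕ω_ (solve (a ∷ b ∷ [])) (solve (a ∷ b ∷ []))

*𝔼-zeroʳ : ∀ x → x *𝔼 0𝔼 ≡ 0𝔼
*𝔼-zeroʳ (a ⊕ω b) = cong₂ _⊕ω_ (solve (a ∷ b ∷ [])) (solve (a ∷ b ∷ []))

*𝔼-distribˡ-+𝔼 : ∀ x y z → x *𝔼 (y +𝔼 z) ≡ x *𝔼 y +𝔼 x *𝔼 z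
*𝔼-distribˡ-+𝔼 (a ⊕ω b) (c ⊕ω d) (e ⊕ω f) = cong₂ _⊕ω_ re-distrib im-distrib
  where
  re-distrib : a * (c + e) - b * (d + f) ≡ (a * c - b * d) + (a * e - b * f)
  re-distrib = solve (a ∷ b ∷ c ∷ d ∷ e ∷ f ∷ [])

  im-distrib : a * (d + f) + b * (c + e) - b * (d + f)
             ≡ (a * d + b * c - b * d) + (a * f + b * e - b * f)
  im-distrib = solve (a ∷ b ∷ c ∷ d ∷ e ∷ f ∷ [])

-𝔼‿distribʳ-*𝔼 : ∀ x y → -𝔼 (x *𝔼 y) ≡ x *𝔼 (-𝔼 y)
-𝔼‿distribʳ-*𝔼 (a ⊕ω b) (c ⊕ω d) = cong₂ _⊕ω_ re-neg im-neg
  where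
  re-neg : - (a * c - b * d) ≡ a * - c - b * - d
  re-neg = solve (a ∷ b ∷ c ∷ d ∷ [])

  im-neg : - (a * d + b * c - b * d) ≡ a * - d + b * - c - b * - d
  im-neg = solve (a ∷ b ∷ c ∷ d ∷ [])

*𝔼-1-isCommutativeMonoid : IsCommutativeMonoid _≡_ _*𝔼_ 1𝔼
*𝔼-1-isCommutativeMonoid = isCommutativeMonoidˡ record
  { isSemigroup = record { isMagma = isMagma _*𝔼_ ; assoc = *𝔼-assoc }
  ; identityˡ   = *𝔼-identityˡ
  ; comm        = *𝔼-comm
  }

*𝔼-1-commutativeMonoid : CommutativeMonoid 0ℓ 0ℓ
*𝔼-1-commutativeMonoid = record { isCommutativeMonoid = *𝔼-1-isCommutativeMonoid }

open CommutativeSemigroupProperties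
  (CommutativeMonoid.commutativeSemigroup *𝔼-1-commutativeMonoid)
  using (interchange; x∙yz≈y∙xz)
open MonoidSum *𝔼-1-commutativeMonoid
  using (sum-remove; ∑-distrib-+; sum-cong-≗; sum-replicate-zero)
  renaming (sum to ∏)

∏a*∏b≡1 : ∀ {n} (a b : Fin n → 𝔼) → (∀ i → a i *𝔼 b i ≡ 1𝔼) → ∏ a *𝔼 ∏ b ≡ 1𝔼
∏a*∏b≡1 {n} a b ab≡1 = begin
  ∏ a *𝔼 ∏ b                 ≡⟨ ∑-distrib-+ a b ⟨
  ∏ (λ i → a i *𝔼 b i)       ≡⟨ sum-cong-≗ ab≡1 ⟩
  ∏ (replicate n 1𝔼)         ≡⟨ sum-replicate-zero n ⟩
  1𝔼                         ∎

infixr 7 _·_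
_·_ : 𝔼 → Poly → Poly
(c · p) k = c *𝔼 p k

constP-· : ∀ c e → c · constP e ≗ constP (c *𝔼 e)
constP-· c e zero    = refl
constP-· c e (suc k) = *𝔼-zeroʳ c

sumTo-cong : ∀ {f g} → f ≗ g → sumTo f ≗ sumTo g
sumTo-cong f≗g zero    = f≗g zero
sumTo-cong f≗g (suc k) = cong₂ _+𝔼_ (sumTo-cong f≗g k) (f≗g (suc k))

sumTo-· : ∀ c f → sumTo (c · f) ≗ c · sumTo f
sumTo-· c f zero    = refl
sumTo-· c f (suc k) = begin
  sumTo (c · f) k +𝔼 c *𝔼 f (suc k)  ≡⟨ cong (_+𝔼 c *𝔼 f (suc k)) (sumTo-· c f k) ⟩
  c *𝔼 sumTo f k +𝔼 c *𝔼 f (suc k)   ≡⟨ *𝔼-distribˡ-+𝔼 c (sumTo f k) (f (suc k)) ⟨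
  c *𝔼 sumTo f (suc k)               ∎

*P-cong : ∀ {p p′ q q′} → p ≗ p′ → q ≗ q′ → p *P q ≗ p′ *P q′
*P-cong p≗p′ q≗q′ k = sumTo-cong (λ i → cong₂ _*𝔼_ (p≗p′ i) (q≗q′ (k ∸ i))) k

*P-congʳ : ∀ p {q q′} → q ≗ q′ → p *P q ≗ p *P q′
*P-congʳ p = *P-cong {p = p} (λ _ → refl)

·-*P : ∀ c p q → (c · p) *P q ≗ c · (p *P q)
·-*P c p q k = trans (sumTo-cong (λ i → *𝔼-assoc c (p i) (q (k ∸ i))) k)
                     (sumTo-· c (λ i → p i *𝔼 q (k ∸ i)) k)

*P-· : ∀ c p q → p *P (c · q) ≗ c · (p *P q)
*P-· c p q k = trans (sumTo-cong (λ i → x∙yz≈y∙xz (p i) c (q (k ∸ i))) k)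
                     (sumTo-· c (λ i → p i *𝔼 q (k ∸ i)) k)

·-*P-· : ∀ c d p q → (c · p) *P (d · q) ≗ (c *𝔼 d) · (p *P q)
·-*P-· c d p q k = begin
  ((c · p) *P (d · q)) k  ≡⟨ ·-*P c p (d · q) k ⟩
  c *𝔼 (p *P (d · q)) k   ≡⟨ cong (c *𝔼_) (*P-· d p q k) ⟩
  c *𝔼 (d *𝔼 (p *P q) k)  ≡⟨ *𝔼-assoc c d _ ⟨
  (c *𝔼 d) *𝔼 (p *P q) k  ∎

altSum-cong : ∀ {n} {f g : Fin n → Poly} → (∀ j → f j ≗ g j) → altSum f ≗ altSum g
altSum-cong {zero}  f≗g k = refl
altSum-cong {suc n} f≗g k =
  cong₂ _+𝔼_ (f≗g zero k) (cong -𝔼_ (altSum-cong (f≗g ∘ suc) k))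

altSum-· : ∀ {n} c (f : Fin n → Poly) → altSum (λ j → c · f j) ≗ c · altSum f
altSum-· {zero}  c f zero    = sym (*𝔼-zeroʳ c)
altSum-· {zero}  c f (suc k) = sym (*𝔼-zeroʳ c)
altSum-· {suc n} c f k = begin
  c *𝔼 f zero k +𝔼 -𝔼 altSum (λ j → c · f (suc j)) k
    ≡⟨ cong (λ s → c *𝔼 f zero k +𝔼 -𝔼 s) (altSum-· c (f ∘ suc) k) ⟩
  c *𝔼 f zero k +𝔼 -𝔼 (c *𝔼 altSum (f ∘ suc) k)
    ≡⟨ cong (c *𝔼 f zero k +𝔼_) (-𝔼‿distribʳ-*𝔼 c _) ⟩
  c *𝔼 f zero k +𝔼 c *𝔼 (-𝔼 altSum (f ∘ suc) k)
    ≡⟨ *𝔼-distribˡ-+𝔼 c _ _ ⟨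
  c *𝔼 altSum f k
    ∎

det-cong : ∀ {n} {M M′ : Matrix Poly n} → (∀ r c → M r c ≗ M′ r c) → det M ≗ det M′
det-cong {zero}  M≗M′ k = refl
det-cong {suc n} M≗M′ =
  altSum-cong (λ j → *P-cong (M≗M′ zero j) (det-cong (λ r c → M≗M′ (suc r) (punchIn j c))))

det-scaleRowsColumns : ∀ {n} (a b : Fin n → 𝔼) (M : Matrix Poly n) →
  det (λ r c → (a r *𝔼 b c) · M r c) ≗ (∏ a *𝔼 ∏ b) · det M
det-scaleRowsColumns {zero}  a b M zero    = refl
det-scaleRowsColumns {zero}  a b M (suc k) = refl
det-scaleRowsColumns {suc n} a b M k =
  trans (altSum-cong expandAlong k) (altSum-· (∏ a *𝔼 ∏ b) (λ j → M zero j *P det (minor j)) k)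
  where
  minor : Fin (suc n) → Matrix Poly n
  minor j r c = M (suc r) (punchIn j c)

  factor : ∀ j → (a zero *𝔼 b j) *𝔼 (∏ (a ∘ suc) *𝔼 ∏ (b ∘ punchIn j)) ≡ ∏ a *𝔼 ∏ b
  factor j = trans (interchange (a zero) (b j) _ _) (cong (∏ a *𝔼_) (sym (sum-remove b)))

  expandAlong : ∀ j →
    ((a zero *𝔼 b j) · M zero j) *P det (λ r c → (a (suc r) *𝔼 b (punchIn j c)) · minor j r c)
      ≗ (∏ a *𝔼 ∏ b) · (M zero j *P det (minor j))
  expandAlong j k = begin
    (((a zero *𝔼 b j) · M zero j) *P det (λ r c → (a (suc r) *𝔼 b (punchIn j c)) · minor j r c)) k
      ≡⟨ *P-congʳ ((a zero *𝔼 b j) · M zero j) (det-scaleRowsColumns (a ∘ suc) (b ∘ punchIn j) (minor j)) k ⟩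
    (((a zero *𝔼 b j) · M zero j) *P ((∏ (a ∘ suc) *𝔼 ∏ (b ∘ punchIn j)) · det (minor j))) k
      ≡⟨ ·-*P-· (a zero *𝔼 b j) (∏ (a ∘ suc) *𝔼 ∏ (b ∘ punchIn j)) (M zero j) (det (minor j)) k ⟩
    ((a zero *𝔼 b j) *𝔼 (∏ (a ∘ suc) *𝔼 ∏ (b ∘ punchIn j))) *𝔼 (M zero j *P det (minor j)) k
      ≡⟨ cong (_*𝔼 (M zero j *P det (minor j)) k) (factor j) ⟩
    (∏ a *𝔼 ∏ b) *𝔼 (M zero j *P det (minor j)) k
      ∎

charMatrix : ∀ {n} → Matrix 𝔼 n → Matrix Poly n
charMatrix H i j = (X *P constP (δ i j)) +P (-P constP (H i j))

scale-δ : ∀ {n} (s : Fin n → Fin n → 𝔼) → (∀ i → s i i ≡ 1𝔼) → ∀ r c → s r c *𝔼 δ r c ≡ δ r c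
scale-δ s sᵢᵢ≡1 zero    zero    = trans (*𝔼-comm (s zero zero) 1𝔼)
                                        (trans (*𝔼-identityˡ _) (sᵢᵢ≡1 zero))
scale-δ s sᵢᵢ≡1 zero    (suc c) = *𝔼-zeroʳ (s zero (suc c))
scale-δ s sᵢᵢ≡1 (suc r) zero    = *𝔼-zeroʳ (s (suc r) zero)
scale-δ s sᵢᵢ≡1 (suc r) (suc c) = scale-δ (λ i j → s (suc i) (suc j)) (sᵢᵢ≡1 ∘ suc) r c

charMatrix-scale : ∀ {n} (s : Fin n → Fin n → 𝔼) → (∀ i → s i i ≡ 1𝔼) →
  (H H′ : Matrix 𝔼 n) → (∀ r c → H′ r c ≡ s r c *𝔼 H r c) →
  ∀ r c → charMatrix H′ r c ≗ s r c · charMatrix H r c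
charMatrix-scale s sᵢᵢ≡1 H H′ H′≡sH r c k =
  trans (cong₂ _+𝔼_ diagonalPart offDiagonalPart) (sym (*𝔼-distribˡ-+𝔼 (s r c) _ _))
  where
  diagonalPart : (X *P constP (δ r c)) k ≡ s r c *𝔼 (X *P constP (δ r c)) k
  diagonalPart = trans
    (*P-congʳ X (λ m → sym (trans (constP-· (s r c) (δ r c) m)
                                  (cong (λ e → constP e m) (scale-δ s sᵢᵢ≡1 r c)))) k)
    (*P-· (s r c) X (constP (δ r c)) k)

  offDiagonalPart : -𝔼 constP (H′ r c) k ≡ s r c *𝔼 (-𝔼 constP (H r c) k)
  offDiagonalPart = begin
    -𝔼 constP (H′ r c) k           ≡⟨ cong (λ e → -𝔼 constP e k) (H′≡sH r c) ⟩
    -𝔼 constP (s r c *𝔼 H r c) k   ≡⟨ cong -𝔼_ (constP-· (s r c) (H r c) k) ⟨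
    -𝔼 (s r c *𝔼 constP (H r c) k) ≡⟨ -𝔼‿distribʳ-*𝔼 (s r c) _ ⟩
    s r c *𝔼 (-𝔼 constP (H r c) k) ∎

charPoly-diagonalSimilarity : ∀ {n} (a b : Fin n → 𝔼) → (∀ i → a i *𝔼 b i ≡ 1𝔼) →
  (H H′ : Matrix 𝔼 n) → (∀ r c → H′ r c ≡ (a r *𝔼 b c) *𝔼 H r c) →
  charPoly H ≗ charPoly H′
charPoly-diagonalSimilarity a b ab≡1 H H′ H′≡abH k = sym (begin
  det (charMatrix H′) k
    ≡⟨ det-cong (charMatrix-scale (λ r c → a r *𝔼 b c) ab≡1 H H′ H′≡abH) k ⟩
  det (λ r c → (a r *𝔼 b c) · charMatrix H r c) k
    ≡⟨ det-scaleRowsColumns a b (charMatrix H) k ⟩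
  (∏ a *𝔼 ∏ b) *𝔼 charPoly H k
    ≡⟨ cong (_*𝔼 charPoly H k) (∏a*∏b≡1 a b ab≡1) ⟩
  1𝔼 *𝔼 charPoly H k
    ≡⟨ *𝔼-identityˡ _ ⟩
  charPoly H k
    ∎)

ω^_ ω̄^_ : Fin 3 → 𝔼
ω^ zero             = 1𝔼
ω^ suc zero         = ω
ω^ suc (suc zero)   = ω̄
ω̄^ zero             = 1𝔼
ω̄^ suc zero         = ω̄
ω̄^ suc (suc zero)   = ω

ω̄^i*ω^i≡1 : ∀ i → ω̄^ i *𝔼 ω^ i ≡ 1𝔼
ω̄^i*ω^i≡1 zero             = refl
ω̄^i*ω^i≡1 (suc zero)       = refl
ω̄^i*ω^i≡1 (suc (suc zero)) = refl

ω̄^i*ω^j≡ω^diff : ∀ i j → ω̄^ i *𝔼 ω^ j ≡ ω^ diff i j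
ω̄^i*ω^j≡ω^diff zero             zero             = refl
ω̄^i*ω^j≡ω^diff zero             (suc zero)       = refl
ω̄^i*ω^j≡ω^diff zero             (suc (suc zero)) = refl
ω̄^i*ω^j≡ω^diff (suc zero)       zero             = refl
ω̄^i*ω^j≡ω^diff (suc zero)       (suc zero)       = refl
ω̄^i*ω^j≡ω^diff (suc zero)       (suc (suc zero)) = refl
ω̄^i*ω^j≡ω^diff (suc (suc zero)) zero             = refl
ω̄^i*ω^j≡ω^diff (suc (suc zero)) (suc zero)       = refl
ω̄^i*ω^j≡ω^diff (suc (suc zero)) (suc (suc zero)) = refl

ω^d*hEntry≡hEntry-switchAdj : ∀ d e → ω^ d *𝔼 hEntry e ≡ hEntry (switchAdj d e)
ω^d*hEntry≡hEntry-switchAdj zero             none = refl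
ω^d*hEntry≡hEntry-switchAdj zero             und  = refl
ω^d*hEntry≡hEntry-switchAdj zero             out  = refl
ω^d*hEntry≡hEntry-switchAdj zero             inn  = refl
ω^d*hEntry≡hEntry-switchAdj (suc zero)       none = refl
ω^d*hEntry≡hEntry-switchAdj (suc zero)       und  = refl
ω^d*hEntry≡hEntry-switchAdj (suc zero)       out  = refl
ω^d*hEntry≡hEntry-switchAdj (suc zero)       inn  = refl
ω^d*hEntry≡hEntry-switchAdj (suc (suc zero)) none = refl
ω^d*hEntry≡hEntry-switchAdj (suc (suc zero)) und  = refl
ω^d*hEntry≡hEntry-switchAdj (suc (suc zero)) out  = refl
ω^d*hEntry≡hEntry-switchAdj (suc (suc zero)) inn  = refl

herm-threeWaySwitch : ∀ {n} (M : MixedGraph n) (part : Fin n → Fin 3) r c →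
  herm (threeWaySwitch part M) r c ≡ (ω̄^ part r *𝔼 ω^ part c) *𝔼 herm M r c
herm-threeWaySwitch M part r c = begin
  hEntry (switchAdj (diff (part r) (part c)) (rel M r c))
    ≡⟨ ω^d*hEntry≡hEntry-switchAdj (diff (part r) (part c)) (rel M r c) ⟨
  ω^ diff (part r) (part c) *𝔼 herm M r c
    ≡⟨ cong (_*𝔼 herm M r c) (ω̄^i*ω^j≡ω^diff (part r) (part c)) ⟨
  (ω̄^ part r *𝔼 ω^ part c) *𝔼 herm M r c
    ∎

corollary3p1 : ∀ {n : ℕ} (M : MixedGraph n) (part : Fin n → Fin 3) →
    Cospectral (herm M) (herm (threeWaySwitch part M))
corollary3p1 M part =
  charPoly-diagonalSimilarity (ω̄^_ ∘ part) (ω^_ ∘ part) (ω̄^i*ω^i≡1 ∘ part)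
    (herm M) (herm (threeWaySwitch part M)) (herm-threeWaySwitch M part)
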